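{- For every instance of the multiplicative assignment problem with upgrades, the set function $X\mapsto\mathrm{cost}(X)$ on subsets of $I$ is supermodular, i.e., for all $A\subseteq I$ and distinct $s,t\in I\setminus A$, $\mathrm{cost}(A)+\mathrm{cost}(A\cup\{s,t\})\ge\mathrm{cost}(A\cup\{s\})+\mathrm{cost}(A\cup\{t\})$.
   Context: Instance: finite sets $I$ (suppliers), $J$ (customers) with $|I|=|J|$, numbers $0\le b_i\le c_i$ ($i\in I$), demands $d_j\ge 0$ ($j\in J$). For $X\subseteq I$, $\mathrm{cost}(X)$ is the minimum over bijections $\pi:J\to I$ of $\sum_{j:\pi(j)\in X}b_{\pi(j)}d_j+\sum_{j:\pi(j)\notin X}c_{\pi(j)}d_j$.
   Formalization: The numbers $b_i$, $c_i$ and the demands $d_j$ of each instance are rational. -}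

module Defs where

open import Data.Nat using (ℕ; zero; suc)
open import Data.Fin using (Fin; zero; suc)
open import Data.Fin.Subset using (Subset)
open import Data.Fin.Permutation using (Permutation′; _⟨$⟩ʳ_)
open import Data.Vec using (lookup)
open import Data.Bool using (if_then_else_)
open import Data.Rational using (ℚ; 0ℚ; _+_; _*_; _≤_)
open import Data.Product using (Σ; _×_)
open import Relation.Binary.PropositionalEquality using (_≡_)

sumFin : (n : ℕ) → (Fin n → ℚ) → ℚ
sumFin zero    f = 0ℚ
sumFin (suc n) f = f zero + sumFin n (λ i → f (suc i))

-- Instance with I = J = Fin n: lower costs b, upper costs c, demands d.
assignCost : (n : ℕ) (b c d : Fin n → ℚ) (X : Subset n) (π : Permutation′ n) → ℚ
assignCost n b c d X π =
  sumFin n (λ j → (if lookup X (π ⟨$⟩ʳ j) then b (π ⟨$⟩ʳ j) else c (π ⟨$⟩ʳ j)) * d j)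

IsCost : (n : ℕ) (b c d : Fin n → ℚ) (X : Subset n) (v : ℚ) → Set
IsCost n b c d X v =
  Σ (Permutation′ n) (λ π → assignCost n b c d X π ≡ v)
  × ((π : Permutation′ n) → v ≤ assignCost n b c d X π)

{-# OPTIONS --safe #-}
-- Let u be the weight vector of A; the weights of A ∪ {s}, A ∪ {t} and A ∪ {s,t} replace u s by b s and/or
-- u t by b t.  By induction on n we show that any assignments π, ρ, priced with A and A ∪ {s,t}, can be traded
-- for σ, τ, priced with A ∪ {s} and A ∪ {t}, of no larger total cost.  Let j be a customer of largest demand
-- and a a supplier of least weight under A; by the rearrangement inequality we may assume π j = a.  If a = s,
-- then σ = π and τ = ρ work: upgrading s in π saves (u s - b s) d j, while undoing the upgrade of s in ρ costs
-- at most as much (symmetrically if a = t).  Otherwise ρ can be made to serve j by a as well, and deleting j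
-- and a leaves a smaller instance of the same shape.  The exception is ρ j = s (or t): then exchanging the
-- labels a and s in the weights that price ρ and σ makes ρ serve j by a, at the price of upgrading s only
-- to u a, which is still at most u s.
module Submission where

open import Defs
open import Data.Nat using (ℕ; zero; suc)
open import Data.Fin using (Fin; zero; suc; punchIn; punchOut)
open import Data.Fin.Properties
  using (_≟_; punchInᵢ≢i; punchIn-injective; punchIn-punchOut; punchOut-injective)
open import Data.Fin.Permutation
  using (Permutation′; _⟨$⟩ʳ_; _⟨$⟩ˡ_; inverseˡ; inverseʳ; _∘ₚ_; transpose; remove; insert;
         insert-punchIn; punchIn-permute)
import Data.Fin.Permutation.Components as PC
open import Data.Fin.Subset using (Subset; _∪_; ⁅_⁆; _∉_)
open import Data.Fin.Subset.Properties using (x∈⁅x⁆; x≢y⇒x∉⁅y⁆; ∪-assoc; ∪-comm)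
open import Data.Vec using (lookup)
open import Data.Vec.Properties using (lookup-zipWith; []=⇒lookup; lookup⇒[]=)
open import Data.Vec.Functional using (Vector; updateAt)
open import Data.Vec.Functional.Properties
  using (updateAt-updates; updateAt-minimal; updateAt-commutes; removeAt-punchOut)
open import Data.Bool using (true; false; if_then_else_; _∨_)
open import Data.Bool.Properties using (∨-identityʳ; ∨-zeroʳ)
open import Data.Rational using (ℚ; 0ℚ; _+_; _*_; _-_; -_; _≤_; nonPositive)
open import Data.Rational.Properties
  using (≤-refl; ≤-trans; ≤-totalPreorder; +-comm; +-assoc; +-inverseʳ; +-mono-≤; +-monoˡ-≤; +-monoʳ-≤;
         *-monoˡ-≤-nonPos; +-0-commutativeMonoid; module ≤-Reasoning)
open import Data.Rational.Solver using (module +-*-Solver)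
open import Algebra.Bundles using (CommutativeMonoid)
open import Algebra.Properties.CommutativeMonoid.Sum +-0-commutativeMonoid
  using (sum; sum-remove; sum-cong-≗)
open import Algebra.Properties.CommutativeSemigroup (CommutativeMonoid.commutativeSemigroup +-0-commutativeMonoid)
  using (xy∙z≈xz∙y)
open import Data.Product using (∃; _×_; _,_; proj₁; proj₂)
open import Data.Sum using (inj₁; inj₂)
open import Function using (_∘_; const; case_of_)
open import Relation.Binary.Bundles using (TotalPreorder)
import Relation.Binary.Construct.Flip.EqAndOrd as Flip
open import Relation.Binary.PropositionalEquality
open import Relation.Nullary using (yes; no; contradiction)

private
  variable
    n : ℕ

infixl 6 _[_]≔_
_[_]≔_ : Vector ℚ n → Fin n → ℚ → Vector ℚ n
w [ i ]≔ x = updateAt w i (const x)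

[]≔-unique : ∀ {v w : Vector ℚ n} {i x} → v i ≡ x → (∀ k → k ≢ i → v k ≡ w k) → v ≗ w [ i ]≔ x
[]≔-unique {w = w} {i} vi≡x agree k with k ≟ i
... | yes refl = trans vi≡x (sym (updateAt-updates k w))
... | no k≢i   = trans (agree k k≢i) (sym (updateAt-minimal k i w k≢i))

[]≔-cong : ∀ {w w′ : Vector ℚ n} {i x x′} → w ≗ w′ → x ≡ x′ → w [ i ]≔ x ≗ w′ [ i ]≔ x′
[]≔-cong {w = w} {i = i} w≗w′ x≡x′ = []≔-unique
  (trans (updateAt-updates i w) x≡x′)
  (λ k k≢i → trans (updateAt-minimal k i w k≢i) (w≗w′ k))

[]≔∘punchIn-self : ∀ (w : Vector ℚ (suc n)) i x → (w [ i ]≔ x) ∘ punchIn i ≗ w ∘ punchIn i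
[]≔∘punchIn-self w i x k = updateAt-minimal (punchIn i k) i w (punchInᵢ≢i i k)

punchIn≡⇒≡punchOut : ∀ {a i : Fin (suc n)} (a≢i : a ≢ i) {k} → punchIn a k ≡ i → k ≡ punchOut a≢i
punchIn≡⇒≡punchOut {a = a} a≢i {k} eq =
  punchIn-injective a k _ (trans eq (sym (punchIn-punchOut a≢i)))

[]≔∘punchIn : ∀ (w : Vector ℚ (suc n)) {a i} (a≢i : a ≢ i) x →
              (w [ i ]≔ x) ∘ punchIn a ≗ (w ∘ punchIn a) [ punchOut a≢i ]≔ x
[]≔∘punchIn w {a} {i} a≢i x = []≔-unique
  (trans (cong (w [ i ]≔ x) (punchIn-punchOut a≢i)) (updateAt-updates i w))
  (λ k k≢i′ → updateAt-minimal (punchIn a k) i w (k≢i′ ∘ punchIn≡⇒≡punchOut a≢i))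

transpose-matchˡ : ∀ (i j : Fin n) → PC.transpose i j i ≡ j
transpose-matchˡ i j with i ≟ i
... | yes _   = refl
... | no i≢i = contradiction refl i≢i

transpose-matchʳ : ∀ (i j : Fin n) → PC.transpose i j j ≡ i
transpose-matchʳ i j with j ≟ i
... | yes j≡i = j≡i
... | no _ with j ≟ j
...   | yes _   = refl
...   | no j≢j = contradiction refl j≢j

transpose-other : ∀ {i j k : Fin n} → k ≢ i → k ≢ j → PC.transpose i j k ≡ k
transpose-other {i = i} {j} {k} k≢i k≢j with k ≟ i
... | yes k≡i = contradiction k≡i k≢i
... | no _ with k ≟ j
...   | yes k≡j = contradiction k≡j k≢j
...   | no _    = refl

∘transpose≗[]≔ : ∀ (w : Vector ℚ n) {q i} → q ≢ i →
                 w ∘ PC.transpose q i ≗ w [ q ]≔ w i [ i ]≔ w q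
∘transpose≗[]≔ w {q} {i} q≢i = []≔-unique (cong w (transpose-matchʳ q i)) agree
  where
  agree : ∀ k → k ≢ i → w (PC.transpose q i k) ≡ (w [ q ]≔ w i) k
  agree k k≢i = case k ≟ q of λ where
    (yes refl) → trans (cong w (transpose-matchˡ k i)) (sym (updateAt-updates k w))
    (no k≢q)   → trans (cong w (transpose-other k≢q k≢i)) (sym (updateAt-minimal k q w k≢q))

[]≔∘transpose∘punchIn : ∀ (w : Vector ℚ (suc n)) {a i} (a≢i : a ≢ i) x →
                        (w [ i ]≔ x) ∘ PC.transpose a i ∘ punchIn a ≗ (w ∘ punchIn a) [ punchOut a≢i ]≔ w a
[]≔∘transpose∘punchIn w {a} {i} a≢i x = []≔-unique
  (trans (cong ((w [ i ]≔ x) ∘ PC.transpose a i) (punchIn-punchOut a≢i))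
         (trans (cong (w [ i ]≔ x) (transpose-matchʳ a i)) (updateAt-minimal a i w a≢i)))
  (λ k k≢i′ → let ak≢i = k≢i′ ∘ punchIn≡⇒≡punchOut a≢i in
    trans (cong (w [ i ]≔ x) (transpose-other (punchInᵢ≢i a k) ak≢i))
          (updateAt-minimal (punchIn a k) i w ak≢i))

cost : Vector ℚ n → Vector ℚ n → Permutation′ n → ℚ
cost w d π = sum (λ j → w (π ⟨$⟩ʳ j) * d j)

cost-cong : ∀ {w w′ : Vector ℚ n} → w ≗ w′ → ∀ d π → cost w d π ≡ cost w′ d π
cost-cong w≗w′ d π = sum-cong-≗ (λ j → cong (_* d j) (w≗w′ (π ⟨$⟩ʳ j)))

cost-remove : ∀ (w d : Vector ℚ (suc n)) π {j i} → π ⟨$⟩ʳ j ≡ i →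
              cost w d π ≡ w i * d j + cost (w ∘ punchIn i) (d ∘ punchIn j) (remove j π)
cost-remove w d π {j} refl = trans (sum-remove {i = j} (λ k → w (π ⟨$⟩ʳ k) * d k))
  (cong (w (π ⟨$⟩ʳ j) * d j +_)
        (sum-cong-≗ λ k → cong (λ i → w i * d (punchIn j k)) (punchIn-permute π j k)))

insert-⟨$⟩ʳ : ∀ j i (σ : Permutation′ n) → insert j i σ ⟨$⟩ʳ j ≡ i
insert-⟨$⟩ʳ j i σ with j ≟ j
... | yes _   = refl
... | no j≢j = contradiction refl j≢j

cost-insert : ∀ (w d : Vector ℚ (suc n)) j i σ →
              cost w d (insert j i σ) ≡ w i * d j + cost (w ∘ punchIn i) (d ∘ punchIn j) σ
cost-insert w d j i σ = trans (sum-remove {i = j} (λ k → w (insert j i σ ⟨$⟩ʳ k) * d k))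
  (cong₂ _+_ (cong (λ i′ → w i′ * d j) (insert-⟨$⟩ʳ j i σ))
             (sum-cong-≗ λ k → cong (λ i′ → w i′ * d (punchIn j k)) (insert-punchIn j i σ k)))

module _ where
  open +-*-Solver
  open ≡-Reasoning

  cost-[]≔ : ∀ (w d : Vector ℚ n) π i x → cost (w [ i ]≔ x) d π ≡ cost w d π + (x - w i) * d (π ⟨$⟩ˡ i)
  cost-[]≔ {suc n} w d π i x = begin
    cost (w [ i ]≔ x) d π
      ≡⟨ cost-remove (w [ i ]≔ x) d π πj≡i ⟩
    (w [ i ]≔ x) i * d j + cost ((w [ i ]≔ x) ∘ punchIn i) d′ π′
      ≡⟨ cong₂ (λ y c → y * d j + c) (updateAt-updates i w) (cost-cong ([]≔∘punchIn-self w i x) d′ π′) ⟩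
    x * d j + c
      ≡⟨ solve 4 (λ x y D c → x :* D :+ c := (y :* D :+ c) :+ (x :- y) :* D) refl x (w i) (d j) c ⟩
    (w i * d j + c) + (x - w i) * d j
      ≡⟨ cong (_+ (x - w i) * d j) (cost-remove w d π πj≡i) ⟨
    cost w d π + (x - w i) * d j
      ∎
    where
    j = π ⟨$⟩ˡ i
    πj≡i = inverseʳ π
    d′ = d ∘ punchIn j
    π′ = remove j π
    c = cost (w ∘ punchIn i) d′ π′

  cost-transpose : ∀ (w d : Vector ℚ n) π {q i} → q ≢ i →
                   cost (w ∘ PC.transpose q i) d π ≡
                   cost w d π + (w i - w q) * (d (π ⟨$⟩ˡ q) - d (π ⟨$⟩ˡ i))
  cost-transpose w d π {q} {i} q≢i = begin
    cost (w ∘ PC.transpose q i) d π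
      ≡⟨ cost-cong (∘transpose≗[]≔ w q≢i) d π ⟩
    cost (w [ q ]≔ w i [ i ]≔ w q) d π
      ≡⟨ cost-[]≔ (w [ q ]≔ w i) d π i (w q) ⟩
    cost (w [ q ]≔ w i) d π + (w q - (w [ q ]≔ w i) i) * e
      ≡⟨ cong₂ (λ c y → c + (w q - y) * e) (cost-[]≔ w d π q (w i)) (updateAt-minimal i q w (q≢i ∘ sym)) ⟩
    cost w d π + (w i - w q) * D + (w q - w i) * e
      ≡⟨ solve 5 (λ c x y D e → c :+ (x :- y) :* D :+ (y :- x) :* e := c :+ (x :- y) :* (D :- e))
                 refl (cost w d π) (w i) (w q) D e ⟩
    cost w d π + (w i - w q) * (D - e)
      ∎
    where
    D = d (π ⟨$⟩ˡ q)
    e = d (π ⟨$⟩ˡ i)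

p≤q⇒p-q≤0 : ∀ {p q} → p ≤ q → p - q ≤ 0ℚ
p≤q⇒p-q≤0 {p} {q} p≤q = subst (p - q ≤_) (+-inverseʳ q) (+-monoˡ-≤ (- q) p≤q)

move-to-max-demand : ∀ (w d : Vector ℚ n) π {j i} → (∀ k → d k ≤ d j) → w i ≤ w (π ⟨$⟩ʳ j) →
                     ∃ λ π′ → π′ ⟨$⟩ʳ j ≡ i × cost w d π′ ≤ cost w d π
move-to-max-demand w d π {j} {i} dmax wi≤wq with π ⟨$⟩ʳ j ≟ i
... | yes πj≡i = π , πj≡i , ≤-refl
... | no q≢i  = π ∘ₚ transpose q i , transpose-matchˡ q i , (begin
  cost (w ∘ PC.transpose q i) d π
    ≡⟨ cost-transpose w d π q≢i ⟩
  cost w d π + δ * (d (π ⟨$⟩ˡ q) - e)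
    ≡⟨ cong (λ k → cost w d π + δ * (d k - e)) (inverseˡ π) ⟩
  cost w d π + δ * (d j - e)
    ≡⟨ solve 4 (λ c δ D e → c :+ δ :* (D :- e) := (c :- δ :* e) :+ δ :* D) refl (cost w d π) δ (d j) e ⟩
  (cost w d π - δ * e) + δ * d j
    ≤⟨ +-monoʳ-≤ (cost w d π - δ * e) (*-monoˡ-≤-nonPos δ (dmax _)) ⟩
  (cost w d π - δ * e) + δ * e
    ≡⟨ solve 3 (λ c δ e → (c :- δ :* e) :+ δ :* e := c) refl (cost w d π) δ e ⟩
  cost w d π
    ∎)
  where
  open +-*-Solver
  open ≤-Reasoning
  q = π ⟨$⟩ʳ j
  δ = w i - w q
  instance δ≤0 = nonPositive (p≤q⇒p-q≤0 wi≤wq)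
  e = d (π ⟨$⟩ˡ i)

record PairCostAtMost (d v₁ v₂ : Vector ℚ n) (B : ℚ) : Set where
  constructor within
  field
    σ τ   : Permutation′ n
    bound : cost v₁ d σ + cost v₂ d τ ≤ B

module _ {d v₁ v₂ : Vector ℚ n} where

  PairCostAtMost-weaken : ∀ {B B′} → B ≤ B′ → PairCostAtMost d v₁ v₂ B → PairCostAtMost d v₁ v₂ B′
  PairCostAtMost-weaken B≤B′ (within σ τ ≤B) = within σ τ (≤-trans ≤B B≤B′)

  PairCostAtMost-swap : ∀ {B} → PairCostAtMost d v₁ v₂ B → PairCostAtMost d v₂ v₁ B
  PairCostAtMost-swap (within σ τ ≤B) = within τ σ (subst (_≤ _) (+-comm (cost v₁ d σ) (cost v₂ d τ)) ≤B)

  PairCostAtMost-cong : ∀ {v₁′ v₂′ B B′} → v₁ ≗ v₁′ → v₂ ≗ v₂′ → B ≡ B′ →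
                        PairCostAtMost d v₁ v₂ B → PairCostAtMost d v₁′ v₂′ B′
  PairCostAtMost-cong v₁≗ v₂≗ refl (within σ τ ≤B) =
    within σ τ (subst (_≤ _) (cong₂ _+_ (cost-cong v₁≗ d σ) (cost-cong v₂≗ d τ)) ≤B)

  PairCostAtMost-relabel : ∀ (ι : Permutation′ n) {B} →
                           PairCostAtMost d (v₁ ∘ (ι ⟨$⟩ʳ_)) v₂ B → PairCostAtMost d v₁ v₂ B
  PairCostAtMost-relabel ι (within σ τ ≤B) = within (σ ∘ₚ ι) τ ≤B

split-common-assignment : ∀ {d v₁ v₂ w₁ w₂ : Vector ℚ (suc n)} {π ρ j a} →
  π ⟨$⟩ʳ j ≡ a → ρ ⟨$⟩ʳ j ≡ a → v₁ a + v₂ a ≡ w₁ a + w₂ a →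
  PairCostAtMost (d ∘ punchIn j) (v₁ ∘ punchIn a) (v₂ ∘ punchIn a)
    (cost (w₁ ∘ punchIn a) (d ∘ punchIn j) (remove j π) +
     cost (w₂ ∘ punchIn a) (d ∘ punchIn j) (remove j ρ)) →
  PairCostAtMost d v₁ v₂ (cost w₁ d π + cost w₂ d ρ)
split-common-assignment {d = d} {v₁} {v₂} {w₁} {w₂} {π} {ρ} {j} {a} πj≡a ρj≡a at-a (within σ τ ≤B) =
  within (insert j a σ) (insert j a τ) (begin
    cost v₁ d (insert j a σ) + cost v₂ d (insert j a τ)
      ≡⟨ cong₂ _+_ (cost-insert v₁ d j a σ) (cost-insert v₂ d j a τ) ⟩
    (v₁ a * d j + c₁) + (v₂ a * d j + c₂)
      ≡⟨ regroup (v₁ a) (v₂ a) c₁ c₂ ⟩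
    (v₁ a + v₂ a) * d j + (c₁ + c₂)
      ≡⟨ cong (λ x → x * d j + (c₁ + c₂)) at-a ⟩
    (w₁ a + w₂ a) * d j + (c₁ + c₂)
      ≤⟨ +-monoʳ-≤ ((w₁ a + w₂ a) * d j) ≤B ⟩
    (w₁ a + w₂ a) * d j + (r₁ + r₂)
      ≡⟨ regroup (w₁ a) (w₂ a) r₁ r₂ ⟨
    (w₁ a * d j + r₁) + (w₂ a * d j + r₂)
      ≡⟨ cong₂ _+_ (cost-remove w₁ d π πj≡a) (cost-remove w₂ d ρ ρj≡a) ⟨
    cost w₁ d π + cost w₂ d ρ
      ∎)
  where
  open ≤-Reasoning
  c₁ = cost (v₁ ∘ punchIn a) (d ∘ punchIn j) σ
  c₂ = cost (v₂ ∘ punchIn a) (d ∘ punchIn j) τ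
  r₁ = cost (w₁ ∘ punchIn a) (d ∘ punchIn j) (remove j π)
  r₂ = cost (w₂ ∘ punchIn a) (d ∘ punchIn j) (remove j ρ)
  regroup : ∀ x y c c′ → (x * d j + c) + (y * d j + c′) ≡ (x + y) * d j + (c + c′)
  regroup x y c c′ = solve 5 (λ x y D c c′ → (x :* D :+ c) :+ (y :* D :+ c′) := (x :+ y) :* D :+ (c :+ c′))
                             refl x y (d j) c c′
    where open +-*-Solver

module _ {a ℓ₁ ℓ₂} (O : TotalPreorder a ℓ₁ ℓ₂) where
  open TotalPreorder O using (Carrier; _≲_; total) renaming (refl to ≲-refl; trans to ≲-trans)

  argmax : (f : Fin (suc n) → Carrier) → ∃ λ i → ∀ k → f k ≲ f i
  argmax {zero} f = zero , λ { zero → ≲-refl }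
  argmax {suc n} f with argmax (f ∘ suc)
  ... | i , max with total (f zero) (f (suc i))
  ...   | inj₁ f₀≲fᵢ = suc i , λ { zero → f₀≲fᵢ ; (suc k) → max k }
  ...   | inj₂ fᵢ≲f₀ = zero , λ { zero → ≲-refl ; (suc k) → ≲-trans (max k) fᵢ≲f₀ }

argmaxℚ : (f : Fin (suc n) → ℚ) → ∃ λ i → ∀ k → f k ≤ f i
argmaxℚ = argmax ≤-totalPreorder

argminℚ : (f : Fin (suc n) → ℚ) → ∃ λ i → ∀ k → f i ≤ f k
argminℚ = argmax (Flip.totalPreorder ≤-totalPreorder)

Exchangeable : (d u : Vector ℚ n) (s t : Fin n) (x y : ℚ) (π ρ : Permutation′ n) → Set
Exchangeable d u s t x y π ρ =
  PairCostAtMost d (u [ s ]≔ x) (u [ t ]≔ y) (cost u d π + cost (u [ t ]≔ y [ s ]≔ x) d ρ)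

Exchangeable-sym : ∀ {d u : Vector ℚ n} {s t x y π ρ} → s ≢ t →
                   Exchangeable d u t s y x π ρ → Exchangeable d u s t x y π ρ
Exchangeable-sym {d = d} {u} {s} {t} {π = π} {ρ} s≢t e =
  PairCostAtMost-cong (λ _ → refl) (λ _ → refl)
    (cong (cost u d π +_) (cost-cong (updateAt-commutes t s (s≢t ∘ sym) u) d ρ))
    (PairCostAtMost-swap e)

exchangeable-at-max-demand : ∀ {d u : Vector ℚ n} {s t x y π j} → s ≢ t → x ≤ u s →
                             (∀ k → d k ≤ d j) → π ⟨$⟩ʳ j ≡ s → ∀ ρ → Exchangeable d u s t x y π ρ
exchangeable-at-max-demand {d = d} {u} {s} {t} {x} {y} {π} {j} s≢t x≤us dmax πj≡s ρ = within π ρ (begin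
  cost (u [ s ]≔ x) d π + h             ≡⟨ cong (_+ h) (cost-[]≔ u d π s x) ⟩
  (c + δ * d (π ⟨$⟩ˡ s)) + h            ≡⟨ cong (λ i → (c + δ * d i) + h) π⁻¹s≡j ⟩
  (c + δ * d j) + h                     ≡⟨ xy∙z≈xz∙y c (δ * d j) h ⟩
  (c + h) + δ * d j                     ≤⟨ +-monoʳ-≤ (c + h) (*-monoˡ-≤-nonPos δ (dmax k)) ⟩
  (c + h) + δ * d k                     ≡⟨ +-assoc c h (δ * d k) ⟩
  c + (h + δ * d k)                     ≡⟨ cong (λ z → c + (h + (x - z) * d k)) (updateAt-minimal s t u s≢t) ⟨
  c + (h + (x - (u [ t ]≔ y) s) * d k)  ≡⟨ cong (c +_) (cost-[]≔ (u [ t ]≔ y) d ρ s x) ⟨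
  c + cost (u [ t ]≔ y [ s ]≔ x) d ρ    ∎)
  where
  open ≤-Reasoning
  c = cost u d π
  h = cost (u [ t ]≔ y) d ρ
  δ = x - u s
  instance δ≤0 = nonPositive (p≤q⇒p-q≤0 x≤us)
  k = ρ ⟨$⟩ˡ s
  π⁻¹s≡j = trans (cong (π ⟨$⟩ˡ_) (sym πj≡s)) (inverseˡ π)

exchangeable-remove-common : ∀ {d u : Vector ℚ (suc n)} {s t a x y π ρ j} (a≢s : a ≢ s) (a≢t : a ≢ t) →
  π ⟨$⟩ʳ j ≡ a → ρ ⟨$⟩ʳ j ≡ a →
  (∀ π′ ρ′ → Exchangeable (d ∘ punchIn j) (u ∘ punchIn a) (punchOut a≢s) (punchOut a≢t) x y
                          π′ ρ′) →
  Exchangeable d u s t x y π ρ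
exchangeable-remove-common {d = d} {u} {s} {t} {a} {x} {y} {π} {ρ} {j} a≢s a≢t πj≡a ρj≡a smaller =
  split-common-assignment {v₁ = u [ s ]≔ x} {u [ t ]≔ y} {u} {LL} {π} {ρ} πj≡a ρj≡a at-a
    (PairCostAtMost-cong (sym ∘ []≔∘punchIn u a≢s x) (sym ∘ []≔∘punchIn u a≢t y)
      (cong (cost (u ∘ punchIn a) d′ (remove j π) +_) (cost-cong (sym ∘ LL∘punchIn) d′ (remove j ρ)))
      (smaller (remove j π) (remove j ρ)))
  where
  LL = u [ t ]≔ y [ s ]≔ x
  d′ = d ∘ punchIn j
  at-a : (u [ s ]≔ x) a + (u [ t ]≔ y) a ≡ u a + LL a
  at-a = cong₂ _+_ (updateAt-minimal a s u a≢s)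
                   (trans (updateAt-minimal a t u a≢t)
                          (sym (trans (updateAt-minimal a s _ a≢s) (updateAt-minimal a t u a≢t))))
  LL∘punchIn : LL ∘ punchIn a ≗ (u ∘ punchIn a) [ punchOut a≢t ]≔ y [ punchOut a≢s ]≔ x
  LL∘punchIn k = trans ([]≔∘punchIn (u [ t ]≔ y) a≢s x k) ([]≔-cong ([]≔∘punchIn u a≢t y) refl k)

exchangeable-relabel : ∀ {d u : Vector ℚ (suc n)} {s t a x y π ρ j} (a≢s : a ≢ s) (a≢t : a ≢ t) →
  π ⟨$⟩ʳ j ≡ a → ρ ⟨$⟩ʳ j ≡ s →
  (∀ π′ ρ′ → Exchangeable (d ∘ punchIn j) (u ∘ punchIn a) (punchOut a≢s) (punchOut a≢t) (u a) y
                          π′ ρ′) →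
  Exchangeable d u s t x y π ρ
exchangeable-relabel {d = d} {u} {s} {t} {a} {x} {y} {π} {ρ} {j} a≢s a≢t πj≡a ρj≡s smaller =
  PairCostAtMost-relabel (transpose a s)
    (PairCostAtMost-cong (λ _ → refl) (λ _ → refl) (cong (cost u d π +_) unrelabel)
      (split-common-assignment {v₁ = (u [ s ]≔ x) ∘ T} {u [ t ]≔ y} {u} {LL ∘ T} {π} {ρ̃} πj≡a ρ̃j≡a at-a
        (PairCostAtMost-cong (sym ∘ []≔∘transpose∘punchIn u a≢s x) (sym ∘ []≔∘punchIn u a≢t y)
          (cong (cost (u ∘ punchIn a) d′ (remove j π) +_) (cost-cong (sym ∘ LL∘T∘punchIn) d′ (remove j ρ̃)))
          (smaller (remove j π) (remove j ρ̃)))))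
  where
  open ≡-Reasoning
  T = PC.transpose a s
  ρ̃ = ρ ∘ₚ transpose s a
  LL = u [ t ]≔ y [ s ]≔ x
  d′ = d ∘ punchIn j
  unrelabel : cost (LL ∘ T) d ρ̃ ≡ cost LL d ρ
  unrelabel = cost-cong {w = LL ∘ T ∘ PC.transpose s a} (λ k → cong LL (PC.transpose-inverse a s {k})) d ρ
  ρ̃j≡a : ρ̃ ⟨$⟩ʳ j ≡ a
  ρ̃j≡a = trans (cong (PC.transpose s a) ρj≡s) (transpose-matchˡ s a)
  at-a : (u [ s ]≔ x) (T a) + (u [ t ]≔ y) a ≡ u a + LL (T a)
  at-a = begin
    (u [ s ]≔ x) (T a) + (u [ t ]≔ y) a
      ≡⟨ cong₂ _+_ (cong (u [ s ]≔ x) (transpose-matchˡ a s)) (updateAt-minimal a t u a≢t) ⟩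
    (u [ s ]≔ x) s + u a  ≡⟨ cong (_+ u a) (updateAt-updates s u) ⟩
    x + u a               ≡⟨ +-comm x (u a) ⟩
    u a + x               ≡⟨ cong (u a +_) (updateAt-updates s (u [ t ]≔ y)) ⟨
    u a + LL s            ≡⟨ cong (λ i → u a + LL i) (transpose-matchˡ a s) ⟨
    u a + LL (T a)        ∎
  LL∘T∘punchIn : LL ∘ T ∘ punchIn a ≗ (u ∘ punchIn a) [ punchOut a≢t ]≔ y [ punchOut a≢s ]≔ u a
  LL∘T∘punchIn k = trans ([]≔∘transpose∘punchIn (u [ t ]≔ y) a≢s x k)
                         ([]≔-cong ([]≔∘punchIn u a≢t y) (updateAt-minimal a t u a≢t) k)

upgrade-exchange : ∀ (d u : Vector ℚ n) {s t} → s ≢ t → ∀ {x y} → x ≤ u s → y ≤ u t →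
                   ∀ π ρ → Exchangeable d u s t x y π ρ
upgrade-exchange {zero} d u {()}
upgrade-exchange {suc n} d u {s} {t} s≢t {x} {y} x≤us y≤ut π ρ =
  PairCostAtMost-weaken (+-monoˡ-≤ (cost LL d ρ) π₁≤π) exchangeable-π₁
  where
  LL = u [ t ]≔ y [ s ]≔ x
  j = proj₁ (argmaxℚ d)
  dmax = proj₂ (argmaxℚ d)
  a = proj₁ (argminℚ u)
  amin = proj₂ (argminℚ u)
  moved = move-to-max-demand u d π dmax (amin (π ⟨$⟩ʳ j))
  π₁ = proj₁ moved
  π₁j≡a = proj₁ (proj₂ moved)
  π₁≤π = proj₂ (proj₂ moved)

  smaller : ∀ {s t} (a≢s : a ≢ s) (a≢t : a ≢ t) → s ≢ t → ∀ {x y} → x ≤ u s → y ≤ u t →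
            ∀ π′ ρ′ → Exchangeable (d ∘ punchIn j) (u ∘ punchIn a) (punchOut a≢s) (punchOut a≢t) x y π′ ρ′
  smaller a≢s a≢t s≢t x≤us y≤ut = upgrade-exchange (d ∘ punchIn j) (u ∘ punchIn a)
    (s≢t ∘ punchOut-injective a≢s a≢t)
    (subst (_ ≤_) (sym (removeAt-punchOut u a≢s)) x≤us)
    (subst (_ ≤_) (sym (removeAt-punchOut u a≢t)) y≤ut)

  LL≡u : ∀ {k} → k ≢ s → k ≢ t → LL k ≡ u k
  LL≡u {k} k≢s k≢t = trans (updateAt-minimal k s _ k≢s) (updateAt-minimal k t u k≢t)

  exchangeable-π₁ : Exchangeable d u s t x y π₁ ρ
  exchangeable-π₁ with a ≟ s | a ≟ t
  ... | yes a≡s | _ = exchangeable-at-max-demand {π = π₁} s≢t x≤us dmax (trans π₁j≡a a≡s) ρ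
  ... | no _ | yes a≡t = Exchangeable-sym {π = π₁} {ρ} s≢t
    (exchangeable-at-max-demand {π = π₁} (s≢t ∘ sym) y≤ut dmax (trans π₁j≡a a≡t) ρ)
  ... | no a≢s | no a≢t with ρ ⟨$⟩ʳ j ≟ s | ρ ⟨$⟩ʳ j ≟ t
  ...   | yes ρj≡s | _ =
    exchangeable-relabel {π = π₁} {ρ} a≢s a≢t π₁j≡a ρj≡s (smaller a≢s a≢t s≢t (amin s) y≤ut)
  ...   | no _ | yes ρj≡t = Exchangeable-sym {π = π₁} {ρ} s≢t
    (exchangeable-relabel {π = π₁} {ρ} a≢t a≢s π₁j≡a ρj≡t
      (smaller a≢t a≢s (s≢t ∘ sym) (amin t) x≤us))
  ...   | no ρj≢s | no ρj≢t =
    PairCostAtMost-weaken (+-monoʳ-≤ (cost u d π₁) ρ₁≤ρ)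
      (exchangeable-remove-common {π = π₁} {ρ₁} a≢s a≢t π₁j≡a ρ₁j≡a
        (smaller a≢s a≢t s≢t x≤us y≤ut))
    where
    moved′ = move-to-max-demand LL d ρ dmax
               (subst₂ _≤_ (sym (LL≡u a≢s a≢t)) (sym (LL≡u ρj≢s ρj≢t)) (amin (ρ ⟨$⟩ʳ j)))
    ρ₁ = proj₁ moved′
    ρ₁j≡a = proj₁ (proj₂ moved′)
    ρ₁≤ρ = proj₂ (proj₂ moved′)

weight : (b c : Vector ℚ n) → Subset n → Vector ℚ n
weight b c X i = if lookup X i then b i else c i

sumFin≡sum : ∀ n (f : Vector ℚ n) → sumFin n f ≡ sum f
sumFin≡sum zero    f = refl
sumFin≡sum (suc n) f = cong (f zero +_) (sumFin≡sum n (f ∘ suc))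

assignCost≡cost : ∀ n (b c d : Vector ℚ n) X π → assignCost n b c d X π ≡ cost (weight b c X) d π
assignCost≡cost n b c d X π = sumFin≡sum n _

∉⇒lookup≡false : ∀ {x : Fin n} {p : Subset n} → x ∉ p → lookup p x ≡ false
∉⇒lookup≡false {x = x} {p} x∉p with lookup p x in eq
... | true  = contradiction (lookup⇒[]= x p eq) x∉p
... | false = refl

weight-∉ : ∀ (b c : Vector ℚ n) {X i} → i ∉ X → weight b c X i ≡ c i
weight-∉ b c {i = i} i∉X = cong (λ v → if v then b i else c i) (∉⇒lookup≡false i∉X)

weight-∪-⁅⁆ : ∀ (b c : Vector ℚ n) X s → weight b c (X ∪ ⁅ s ⁆) ≗ weight b c X [ s ]≔ b s
weight-∪-⁅⁆ b c X s = []≔-unique (cong (λ v → if v then b s else c s) s∈X∪⁅s⁆) off-s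
  where
  s∈X∪⁅s⁆ : lookup (X ∪ ⁅ s ⁆) s ≡ true
  s∈X∪⁅s⁆ = trans (lookup-zipWith _∨_ s X ⁅ s ⁆)
                  (trans (cong (lookup X s ∨_) ([]=⇒lookup (x∈⁅x⁆ s))) (∨-zeroʳ _))
  off-s : ∀ k → k ≢ s → weight b c (X ∪ ⁅ s ⁆) k ≡ weight b c X k
  off-s k k≢s = cong (λ v → if v then b k else c k)
    (trans (lookup-zipWith _∨_ k X ⁅ s ⁆)
           (trans (cong (lookup X k ∨_) (∉⇒lookup≡false (x≢y⇒x∉⁅y⁆ k≢s))) (∨-identityʳ _)))

weight-∪-⁅⁆-⁅⁆ : ∀ (b c : Vector ℚ n) X s t →
                 weight b c (X ∪ (⁅ s ⁆ ∪ ⁅ t ⁆)) ≗ weight b c X [ t ]≔ b t [ s ]≔ b s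
weight-∪-⁅⁆-⁅⁆ b c X s t k = begin
  weight b c (X ∪ (⁅ s ⁆ ∪ ⁅ t ⁆)) k      ≡⟨ cong (λ Y → weight b c (X ∪ Y) k) (∪-comm ⁅ s ⁆ ⁅ t ⁆) ⟩
  weight b c (X ∪ (⁅ t ⁆ ∪ ⁅ s ⁆)) k      ≡⟨ cong (λ Y → weight b c Y k) (∪-assoc X ⁅ t ⁆ ⁅ s ⁆) ⟨
  weight b c ((X ∪ ⁅ t ⁆) ∪ ⁅ s ⁆) k      ≡⟨ weight-∪-⁅⁆ b c (X ∪ ⁅ t ⁆) s k ⟩
  (weight b c (X ∪ ⁅ t ⁆) [ s ]≔ b s) k   ≡⟨ []≔-cong (weight-∪-⁅⁆ b c X t) refl k ⟩
  (weight b c X [ t ]≔ b t [ s ]≔ b s) k  ∎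
  where open ≡-Reasoning

lemmaB2 : (n : ℕ) (b c d : Fin n → ℚ)
          → ((i : Fin n) → 0ℚ ≤ b i) → ((i : Fin n) → b i ≤ c i) → ((j : Fin n) → 0ℚ ≤ d j)
          → (A : Subset n) (s t : Fin n) → s ∉ A → t ∉ A → s ≢ t
          → (vA vAs vAt vAst : ℚ)
          → IsCost n b c d A vA
          → IsCost n b c d (A ∪ ⁅ s ⁆) vAs
          → IsCost n b c d (A ∪ ⁅ t ⁆) vAt
          → IsCost n b c d (A ∪ (⁅ s ⁆ ∪ ⁅ t ⁆)) vAst
          → vAs + vAt ≤ vA + vAst
lemmaB2 n b c d _ b≤c _ A s t s∉A t∉A s≢t vA vAs vAt vAst
        ((πA , πA-cost) , _) (_ , vAs-min) (_ , vAt-min) ((πAst , πAst-cost) , _) =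
  bound (upgrade-exchange d u s≢t (b≤u s∉A) (b≤u t∉A) πA πAst)
  where
  open ≤-Reasoning
  u = weight b c A
  b≤u : ∀ {i} → i ∉ A → b i ≤ u i
  b≤u i∉A = subst (b _ ≤_) (sym (weight-∉ b c i∉A)) (b≤c _)
  bound : Exchangeable d u s t (b s) (b t) πA πAst → vAs + vAt ≤ vA + vAst
  bound (within σ τ σ+τ≤) = begin
    vAs + vAt
      ≤⟨ +-mono-≤ (vAs-min σ) (vAt-min τ) ⟩
    assignCost n b c d (A ∪ ⁅ s ⁆) σ + assignCost n b c d (A ∪ ⁅ t ⁆) τ
      ≡⟨ cong₂ _+_
           (trans (assignCost≡cost n b c d (A ∪ ⁅ s ⁆) σ) (cost-cong (weight-∪-⁅⁆ b c A s) d σ))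
           (trans (assignCost≡cost n b c d (A ∪ ⁅ t ⁆) τ) (cost-cong (weight-∪-⁅⁆ b c A t) d τ)) ⟩
    cost (u [ s ]≔ b s) d σ + cost (u [ t ]≔ b t) d τ
      ≤⟨ σ+τ≤ ⟩
    cost u d πA + cost (u [ t ]≔ b t [ s ]≔ b s) d πAst
      ≡⟨ cong₂ _+_
           (trans (sym (assignCost≡cost n b c d A πA)) πA-cost)
           (trans (cost-cong (sym ∘ weight-∪-⁅⁆-⁅⁆ b c A s t) d πAst)
                  (trans (sym (assignCost≡cost n b c d (A ∪ (⁅ s ⁆ ∪ ⁅ t ⁆)) πAst)) πAst-cost)) ⟩
    vA + vAst ∎
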